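{- Let $s,m$ be positive integers with $ms\geq 2$. There is a unique partition with the largest number of parts among all partitions that are simultaneously $s$-cores, $(ms-1)$-cores and $(ms+1)$-cores, and its set of first-column hook lengths is $$\{\,i+\ell s+j\,ms : 0\leq\ell\leq m-2,\ 1\leq i\leq s-1,\ 0\leq j\leq \min(i-1,s-i-1)\,\}\ \cup\ \{\,i+(m-1)s+j\,ms : 1\leq i\leq s-2,\ 0\leq j\leq \min(i-1,s-i-2)\,\}.$$ Equivalently its minimal $ms$-abacus has beads exactly at positions $(i+\ell s,j)$ for the indicated ranges of $\ell,i,j$.
   Context: An $a$-core is a partition with no hook length equal to $a$ (hook length of a box = boxes weakly right in its row plus boxes strictly below in its column). The first-column hook lengths are the hook lengths of the boxes in the first column. The minimal $N$-abacus of a partition places a bead at $(i,j)$ ($0\le i\le N-1$, $j\ge0$) exactly when $i+jN$ is a first-column hook length. -}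

module Defs where

open import Data.Nat using (ℕ; zero; suc; _+_; _*_; _∸_; _≤_; _<_; _<?_)
open import Data.List using (List; []; _∷_; length; filter)
open import Data.List.Relation.Unary.All using (All)
open import Data.List.Relation.Unary.Linked using (Linked)
open import Data.Nat using (_≥_)
open import Data.Product using (Σ; ∃; _×_)
open import Data.Sum using (_⊎_)
open import Relation.Nullary using (¬_)
open import Relation.Binary.PropositionalEquality using (_≡_)

-- A partition is a weakly decreasing list of positive parts
-- (row lengths of the Young diagram, top row first).
IsPartition : List ℕ → Set
IsPartition λ′ = Linked _≥_ λ′ × All (λ x → 0 < x) λ′

-- length of row r (0-indexed); 0 beyond the last row
row : List ℕ → ℕ → ℕ
row []       _       = 0
row (x ∷ _)  zero    = x
row (_ ∷ xs) (suc r) = row xs r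

col : List ℕ → ℕ → ℕ
col λ′ c = length (filter (c <?_) λ′)

-- hook length of box (r , c): boxes weakly right in its row
-- plus boxes strictly below in its column
hook : List ℕ → ℕ → ℕ → ℕ
hook λ′ r c = (row λ′ r ∸ c) + (col λ′ c ∸ suc r)

HasHook : ℕ → List ℕ → Set
HasHook a λ′ = ∃ λ r → ∃ λ c → c < row λ′ r × hook λ′ r c ≡ a

IsCore : ℕ → List ℕ → Set
IsCore a λ′ = ¬ HasHook a λ′

FirstColHook : List ℕ → ℕ → Set
FirstColHook λ′ h = ∃ λ r → r < length λ′ × hook λ′ r 0 ≡ h

SimCore : ℕ → ℕ → List ℕ → Set
SimCore s m λ′ = IsCore s λ′ × IsCore (m * s ∸ 1) λ′ × IsCore (m * s + 1) λ′

Target : ℕ → ℕ → ℕ → Set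
Target s m h =
  (∃ λ ℓ → ∃ λ i → ∃ λ j →
     ℓ + 2 ≤ m × 1 ≤ i × i + 1 ≤ s × j ≤ i ∸ 1 × j ≤ s ∸ i ∸ 1 ×
     h ≡ i + ℓ * s + j * (m * s))
  ⊎
  (∃ λ i → ∃ λ j →
     1 ≤ i × i + 2 ≤ s × j ≤ i ∸ 1 × j ≤ s ∸ i ∸ 2 ×
     h ≡ i + (m ∸ 1) * s + j * (m * s))

module Submission where

-- A partition ν is encoded by the list fcHooks ν of its first-column hook
-- lengths, a strictly decreasing list of positive numbers (the beads of its
-- abacus) whose length is the number of parts; every such list comes from
-- exactly one partition (fromHooks).  A hook of length a in row r is the same
-- thing as a number y missing from fcHooks ν lying exactly a below the
-- first-column hook of row r (HookDictionary).  Hence, for a ≥ 1, ν is an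
-- a-core iff fcHooks ν is closed under subtracting a, and a simultaneous
-- s-, (ms - 1)-, (ms + 1)-core has no first-column hook in the numerical
-- semigroup generated by s, ms - 1 and ms + 1.
-- Writing numbers as i + ℓ s + j ms (Numerics), every number is either in that
-- semigroup or one of the beads of the statement, and the beads are closed
-- under subtracting the three generators.  So the partition μ whose
-- first-column hooks are the beads is a simultaneous core, the first-column
-- hooks of any other one form a sub-list of the beads, and comparing strictly
-- decreasing lists (⊆-length, ⊆-equal) gives maximality and uniqueness.

open import Defs
open import Algebra.Properties.CommutativeSemigroup using (interchange)
open import Data.Nat
open import Data.Nat.Properties
open import Data.Nat.DivMod using (_/_; _%_; m≡m%n+[m/n]*n; m%n<n; m<n*o⇒m/o<n)
open import Data.Nat.Tactic.RingSolver using (solve-∀)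
open import Data.List using (List; []; _∷_; length; filter; downFrom)
open import Data.List.Properties using (∷-injective; filter-accept; filter-reject; filter-all; length-filter)
open import Data.List.Relation.Unary.All using (All; []; _∷_; tabulate)
open import Data.List.Relation.Unary.Any using (here; there)
open import Data.List.Relation.Unary.Linked as Linked using (Linked; []; [-]; _∷_)
open import Data.List.Relation.Unary.Linked.Properties using (filter⁺; applyDownFrom⁺₂)
open import Data.List.Relation.Binary.Subset.Propositional using (_⊆_)
open import Data.List.Membership.Propositional using (_∈_; _∉_)
open import Data.List.Membership.Propositional.Properties using (∈-filter⁺; ∈-filter⁻; ∈-downFrom⁺)
open import Data.List.Membership.DecPropositional _≟_ using (_∈?_)
open import Data.Product using (Σ; ∃; _×_; _,_; proj₁; proj₂; uncurry)
open import Data.Sum using (_⊎_; inj₁; inj₂; [_,_]′)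
open import Data.Empty using (⊥-elim)
open import Relation.Nullary using (yes; no; Dec)
open import Relation.Nullary.Decidable using (_×-dec_; _⊎-dec_; map′)
open import Relation.Binary.Definitions using (tri<; tri≈; tri>)
open import Relation.Binary.PropositionalEquality
open import Function.Base using (_∘_)
open import Function.Bundles using (_⇔_; mk⇔; Equivalence)
open import Function.Properties.Equivalence using () renaming (trans to ⇔-trans; sym to ⇔-sym)

row-beyond : ∀ L {t} → length L ≤ t → row L t ≡ 0
row-beyond []      _       = refl
row-beyond (x ∷ L) (s≤s p) = row-beyond L p

row-positive : ∀ {L} → All (0 <_) L → ∀ {t} → t < length L → 0 < row L t
row-positive (p ∷ _)  {zero}  _       = p
row-positive (_ ∷ ps) {suc t} (s≤s q) = row-positive ps q

row-nonempty : ∀ L {t} → 0 < row L t → t < length L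
row-nonempty L {t} pos = ≰⇒> λ k≤t → <-irrefl (sym (row-beyond L k≤t)) pos

row-≤-head : ∀ {x L} → Linked _≥_ (x ∷ L) → ∀ t → row L t ≤ x
row-≤-head [-]     t       = z≤n
row-≤-head (p ∷ l) zero    = p
row-≤-head (p ∷ l) (suc t) = ≤-trans (row-≤-head l t) p

row-antitone : ∀ {L} → Linked _≥_ L → ∀ {t t′} → t ≤ t′ → row L t′ ≤ row L t
row-antitone {[]}    l {t}     {t′}     p       = z≤n
row-antitone {x ∷ L} l {zero}  {zero}   p       = ≤-refl
row-antitone {x ∷ L} l {zero}  {suc t′} p       = row-≤-head l t′
row-antitone {x ∷ L} l {suc t} {suc t′} (s≤s p) = row-antitone (Linked.tail l) p

col⇒row : ∀ {L} → Linked _≥_ L → ∀ c t → t < col L c → c < row L t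
col⇒row {x ∷ L} l c t p with c <? x
col⇒row {x ∷ L} l c zero    p | yes c<x = c<x
col⇒row {x ∷ L} l c (suc t) p | yes c<x
  rewrite filter-accept (c <?_) {xs = L} c<x = col⇒row (Linked.tail l) c t (s≤s⁻¹ p)
col⇒row {x ∷ L} l c t       p | no c≮x
  rewrite filter-reject (c <?_) {xs = L} c≮x =
    ⊥-elim (c≮x (<-≤-trans (col⇒row (Linked.tail l) c t p) (row-≤-head l t)))

row⇒col : ∀ {L} → Linked _≥_ L → ∀ c t → c < row L t → t < col L c
row⇒col {x ∷ L} l c t p with c <? x
row⇒col {x ∷ L} l c zero    p | yes c<x rewrite filter-accept (c <?_) {xs = L} c<x = s≤s z≤n
row⇒col {x ∷ L} l c (suc t) p | yes c<x
  rewrite filter-accept (c <?_) {xs = L} c<x = s≤s (row⇒col (Linked.tail l) c t p)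
row⇒col {x ∷ L} l c zero    p | no c≮x = ⊥-elim (c≮x p)
row⇒col {x ∷ L} l c (suc t) p | no c≮x = ⊥-elim (c≮x (<-≤-trans p (row-≤-head l t)))

col≤length : ∀ L c → col L c ≤ length L
col≤length L c = length-filter (c <?_) L

col-zero : ∀ {L} → All (0 <_) L → col L 0 ≡ length L
col-zero ps = cong length (filter-all (0 <?_) ps)

col-char : ∀ {L} → Linked _≥_ L → ∀ c p →
  (∀ t → t < p → c < row L t) → (∀ t → p ≤ t → row L t ≤ c) → col L c ≡ p
col-char l c p inside outside = ≤-antisym
  (≮⇒≥ λ p<col → <⇒≱ (col⇒row l c p p<col) (outside p ≤-refl))
  (≮⇒≥ λ col<p → <-irrefl refl (row⇒col l c _ (inside _ col<p)))

fcHooks : List ℕ → List ℕ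
fcHooks []      = []
fcHooks (x ∷ L) = x + length L ∷ fcHooks L

length-fcHooks : ∀ L → length (fcHooks L) ≡ length L
length-fcHooks []      = refl
length-fcHooks (x ∷ L) = cong suc (length-fcHooks L)

row-fcHooks : ∀ L t → row (fcHooks L) t ≡ row L t + (length L ∸ suc t)
row-fcHooks []      t       = refl
row-fcHooks (x ∷ L) zero    = refl
row-fcHooks (x ∷ L) (suc t) = row-fcHooks L t

hook-col0 : ∀ {L} → IsPartition L → ∀ r → hook L r 0 ≡ row (fcHooks L) r
hook-col0 {L} (_ , ps) r rewrite col-zero ps = sym (row-fcHooks L r)

∈⇔row : ∀ L h → h ∈ L ⇔ (∃ λ r → r < length L × row L r ≡ h)
∈⇔row L h = mk⇔ (to L) (from L)
  where
  to : ∀ L → h ∈ L → ∃ λ r → r < length L × row L r ≡ h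
  to (x ∷ L) (here refl) = 0 , s≤s z≤n , refl
  to (x ∷ L) (there p) with to L p
  ... | r , r<k , eq = suc r , s≤s r<k , eq
  from : ∀ L → (∃ λ r → r < length L × row L r ≡ h) → h ∈ L
  from (x ∷ L) (zero  , _       , refl) = here refl
  from (x ∷ L) (suc r , s≤s r<k , eq)   = there (from L (r , r<k , eq))

row∈ : ∀ L {r} → r < length L → row L r ∈ L
row∈ L r<k = Equivalence.from (∈⇔row L _) (_ , r<k , refl)

FirstColHook⇔∈ : ∀ {L} → IsPartition L → ∀ h → FirstColHook L h ⇔ h ∈ fcHooks L
FirstColHook⇔∈ {L} P h = mk⇔
  (λ { (r , r<k , eq) → Equivalence.from (∈⇔row (fcHooks L) h)
         (r , subst (r <_) (sym (length-fcHooks L)) r<k , trans (sym (hook-col0 P r)) eq) })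
  (λ h∈ → let (r , r<k , eq) = Equivalence.to (∈⇔row (fcHooks L) h) h∈
          in r , subst (r <_) (length-fcHooks L) r<k , trans (hook-col0 P r) eq)

fcHooks-strict : ∀ {L} → Linked _≥_ L → Linked _>_ (fcHooks L)
fcHooks-strict []                  = []
fcHooks-strict [-]                 = [-]
fcHooks-strict {x ∷ y ∷ L} (p ∷ l) = +-mono-≤-< p (n<1+n (length L)) ∷ fcHooks-strict l

0∉fcHooks : ∀ {L} → IsPartition L → 0 ∉ fcHooks L
0∉fcHooks {L} (_ , ps) 0∈ with Equivalence.to (∈⇔row (fcHooks L) 0) 0∈
... | r , r<k , eq = <-irrefl (sym eq) (begin-strict
  0                                <⟨ row-positive ps (subst (r <_) (length-fcHooks L) r<k) ⟩
  row L r                          ≤⟨ m≤m+n _ _ ⟩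
  row L r + (length L ∸ suc r)     ≡⟨ sym (row-fcHooks L r) ⟩
  row (fcHooks L) r                ∎)
  where open ≤-Reasoning

fcHooks-injective : ∀ L L′ → fcHooks L ≡ fcHooks L′ → L ≡ L′
fcHooks-injective []      []        eq = refl
fcHooks-injective (x ∷ L) (x′ ∷ L′) eq
  with heads , tails ← ∷-injective eq
  with refl ← fcHooks-injective L L′ tails
  = cong (_∷ L) (+-cancelʳ-≡ (length L) x x′ heads)

fromHooks : List ℕ → List ℕ
fromHooks []      = []
fromHooks (h ∷ H) = h ∸ length H ∷ fromHooks H

length-fromHooks : ∀ H → length (fromHooks H) ≡ length H
length-fromHooks []      = refl
length-fromHooks (h ∷ H) = cong suc (length-fromHooks H)

length<head : ∀ {h H} → Linked _>_ (h ∷ H) → All (0 <_) (h ∷ H) → length H < h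
length<head [-]     (p ∷ _)  = p
length<head (p ∷ l) (_ ∷ ps) = ≤-<-trans (length<head l ps) p

fcHooks-fromHooks : ∀ {H} → Linked _>_ H → All (0 <_) H → fcHooks (fromHooks H) ≡ H
fcHooks-fromHooks {[]}    l ps = refl
fcHooks-fromHooks {h ∷ H} l ps@(_ ∷ ps′) = cong₂ _∷_
  (trans (cong (h ∸ length H +_) (length-fromHooks H)) (m∸n+n≡m (<⇒≤ (length<head l ps))))
  (fcHooks-fromHooks (Linked.tail l) ps′)

fromHooks-partition : ∀ {H} → Linked _>_ H → All (0 <_) H → IsPartition (fromHooks H)
fromHooks-partition l ps = decreasing l ps , positive l ps
  where
  decreasing : ∀ {H} → Linked _>_ H → All (0 <_) H → Linked _≥_ (fromHooks H)
  decreasing []                     _         = []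
  decreasing [-]                    _         = [-]
  decreasing {h ∷ h′ ∷ H} (p ∷ l) (_ ∷ ps) = ∸-monoˡ-≤ (suc (length H)) p ∷ decreasing l ps
  positive : ∀ {H} → Linked _>_ H → All (0 <_) H → All (0 <_) (fromHooks H)
  positive {[]}    _ _              = []
  positive {h ∷ H} l ps@(_ ∷ ps′) = m<n⇒0<n∸m (length<head l ps) ∷ positive (Linked.tail l) ps′

∸-telescope : ∀ {a b c} → a ≤ b → b ≤ c → (b ∸ a) + (c ∸ b) ≡ c ∸ a
∸-telescope {a} {b} {c} a≤b b≤c = begin
  (b ∸ a) + (c ∸ b) ≡⟨ +-comm (b ∸ a) (c ∸ b) ⟩
  (c ∸ b) + (b ∸ a) ≡⟨ sym (+-∸-assoc (c ∸ b) a≤b) ⟩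
  (c ∸ b) + b ∸ a   ≡⟨ cong (_∸ a) (m∸n+n≡m b≤c) ⟩
  c ∸ a             ∎
  where open ≡-Reasoning

module HookDictionary {ν : List ℕ} (P : IsPartition ν) where

  k : ℕ
  k = length ν

  R H : ℕ → ℕ
  R = row ν
  H = row (fcHooks ν)

  decreasing : Linked _≥_ ν
  decreasing = proj₁ P

  hooks-decreasing : Linked _≥_ (fcHooks ν)
  hooks-decreasing = Linked.map <⇒≤ (fcHooks-strict decreasing)

  H∈ : ∀ {t} → t < k → H t ∈ fcHooks ν
  H∈ t<k = row∈ (fcHooks ν) (subst (_ <_) (sym (length-fcHooks ν)) t<k)

  -- The gap associated with column c: first-column hook minus hook length.
  gap : ℕ → ℕ
  gap c = c + (k ∸ col ν c)

  hook-decomposition : ∀ r c → c < R r → hook ν r c + gap c ≡ H r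
  hook-decomposition r c c<R = begin
    (R r ∸ c) + (C ∸ suc r) + (c + (k ∸ C))
      ≡⟨ interchange +-commutativeSemigroup (R r ∸ c) (C ∸ suc r) c (k ∸ C) ⟩
    (R r ∸ c + c) + ((C ∸ suc r) + (k ∸ C))
      ≡⟨ cong₂ _+_ (m∸n+n≡m (<⇒≤ c<R)) (∸-telescope r<C C≤k) ⟩
    R r + (k ∸ suc r)
      ≡⟨ sym (row-fcHooks ν r) ⟩
    H r ∎
    where
    open ≡-Reasoning
    C : ℕ
    C = col ν c
    r<C : r < C
    r<C = row⇒col decreasing c r c<R
    C≤k : C ≤ k
    C≤k = col≤length ν c

  -- Rows meeting column c have first-column hook above the gap, the others below.
  gap∉fcHooks : ∀ c → gap c ∉ fcHooks ν
  gap∉fcHooks c gap∈ with Equivalence.to (∈⇔row (fcHooks ν) (gap c)) gap∈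
  ... | t , t<k′ , Ht≡gap with t <? col ν c
  ...   | yes t<C = <-irrefl (sym Ht≡gap) (begin-strict
    c + (k ∸ col ν c)     <⟨ +-monoˡ-< _ (col⇒row decreasing c t t<C) ⟩
    R t + (k ∸ col ν c)   ≤⟨ +-monoʳ-≤ (R t) (∸-monoʳ-≤ k t<C) ⟩
    R t + (k ∸ suc t)     ≡⟨ sym (row-fcHooks ν t) ⟩
    H t                   ∎)
    where open ≤-Reasoning
  ...   | no t≮C = <-irrefl Ht≡gap (begin-strict
    H t                   ≡⟨ row-fcHooks ν t ⟩
    R t + (k ∸ suc t)     <⟨ +-monoʳ-< (R t) (∸-monoʳ-< (s≤s (≮⇒≥ t≮C)) t<k) ⟩
    R t + (k ∸ col ν c)   ≤⟨ +-monoˡ-≤ _ (≮⇒≥ (t≮C ∘ row⇒col decreasing c t)) ⟩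
    c + (k ∸ col ν c)     ∎)
    where
    open ≤-Reasoning
    t<k : t < k
    t<k = subst (t <_) (length-fcHooks ν) t<k′

  -- A hook of length g in row r exhibits H r = g + x with x a gap, so a
  -- partition whose first-column hooks are closed under subtracting g is a g-core.
  closed⇒core : ∀ g → (∀ x → g + x ∈ fcHooks ν → x ∈ fcHooks ν) → IsCore g ν
  closed⇒core g closed (r , c , c<R , hook≡g) =
    gap∉fcHooks c (closed (gap c) (subst (_∈ fcHooks ν) Hr≡g+gap (H∈ r<k)))
    where
    r<k : r < k
    r<k = row-nonempty ν (≤-<-trans z≤n c<R)
    Hr≡g+gap : H r ≡ g + gap c
    Hr≡g+gap = trans (sym (hook-decomposition r c c<R)) (cong (_+ gap c) hook≡g)

  -- Conversely, a number y missing from the first-column hooks, below the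
  -- first-column hook of row r, yields a box in row r of hook length H r ∸ y:
  -- its column c is chosen so that gap c ≡ y.
  module Missing (y : ℕ) (y∉ : y ∉ fcHooks ν) where

    -- the number of rows whose first-column hook exceeds y
    p : ℕ
    p = col (fcHooks ν) y

    p≤k : p ≤ k
    p≤k = subst (p ≤_) (length-fcHooks ν) (col≤length (fcHooks ν) y)

    H-below : ∀ {t} → p ≤ t → t < k → H t < y
    H-below {t} p≤t t<k = ≤∧≢⇒<
      (≮⇒≥ λ y<Ht → <⇒≱ (row⇒col hooks-decreasing y t y<Ht) p≤t)
      (λ Ht≡y → y∉ (subst (_∈ fcHooks ν) Ht≡y (H∈ t<k)))

    row-p-bound : p < k → R p + k ≤ y + p
    row-p-bound p<k = begin
      R p + k                  ≡⟨ cong (R p +_) (sym (m∸n+n≡m p≤k)) ⟩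
      R p + ((k ∸ p) + p)      ≡⟨ sym (+-assoc (R p) (k ∸ p) p) ⟩
      R p + (k ∸ p) + p        ≡⟨ cong (λ z → R p + z + p) (+-∸-assoc 1 p<k) ⟩
      R p + suc (k ∸ suc p) + p ≡⟨ cong (_+ p) (+-suc (R p) (k ∸ suc p)) ⟩
      suc (R p + (k ∸ suc p)) + p ≤⟨ +-monoˡ-≤ p (subst (_< y) (row-fcHooks ν p) (H-below ≤-refl p<k)) ⟩
      y + p                    ∎
      where open ≤-Reasoning

    k≤y+p : k ≤ y + p
    k≤y+p with p <? k
    ... | yes p<k = ≤-trans (m≤n+m k (R p)) (row-p-bound p<k)
    ... | no  p≮k = ≤-trans (≮⇒≥ p≮k) (m≤n+m p y)

    c : ℕ
    c = y + p ∸ k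

    -- column c meets exactly the rows above p, so it has length p and gap c ≡ y
    outside : ∀ t → p ≤ t → R t ≤ c
    outside t p≤t with t <? k
    ... | yes t<k = ≤-trans (row-antitone decreasing p≤t)
                      (m+n≤o⇒m≤o∸n (R p) (row-p-bound (≤-<-trans p≤t t<k)))
    ... | no  t≮k = subst (_≤ c) (sym (row-beyond ν (≮⇒≥ t≮k))) z≤n

    inside : ∀ t → t < p → c < R t
    inside t t<p = <-≤-trans c<Rq (row-antitone decreasing (s≤s⁻¹ (subst (t <_) p≡1+q t<p)))
      where
      q : ℕ
      q = pred p
      p≡1+q : p ≡ suc q
      p≡1+q = sym (suc-pred p {{>-nonZero (≤-<-trans z≤n t<p)}})
      y<Rq+[k∸p] : y < R q + (k ∸ p)
      y<Rq+[k∸p] = subst (y <_)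
        (trans (row-fcHooks ν q) (cong (λ z → R q + (k ∸ z)) (sym p≡1+q)))
        (col⇒row hooks-decreasing y q (subst (q <_) (sym p≡1+q) ≤-refl))
      c<Rq : c < R q
      c<Rq = begin-strict
        y + p ∸ k             <⟨ ∸-monoˡ-< (+-monoˡ-< p y<Rq+[k∸p]) k≤y+p ⟩
        R q + (k ∸ p) + p ∸ k ≡⟨ cong (_∸ k) (+-assoc (R q) (k ∸ p) p) ⟩
        R q + (k ∸ p + p) ∸ k ≡⟨ cong (λ z → R q + z ∸ k) (m∸n+n≡m p≤k) ⟩
        R q + k ∸ k           ≡⟨ m+n∸n≡m (R q) k ⟩
        R q                   ∎
        where open ≤-Reasoning

    col-c : col ν c ≡ p
    col-c = col-char decreasing c p inside outside

    gap-c : gap c ≡ y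
    gap-c = begin
      c + (k ∸ col ν c)       ≡⟨ cong (λ z → c + (k ∸ z)) col-c ⟩
      (y + p ∸ k) + (k ∸ p)   ≡⟨ +-comm (y + p ∸ k) (k ∸ p) ⟩
      (k ∸ p) + (y + p ∸ k)   ≡⟨ ∸-telescope p≤k k≤y+p ⟩
      y + p ∸ p               ≡⟨ m+n∸n≡m y p ⟩
      y                       ∎
      where open ≡-Reasoning

    missing⇒hook : ∀ r → y < H r → ∃ λ c → c < R r × hook ν r c + y ≡ H r
    missing⇒hook r y<Hr = c , c<R , subst (λ z → hook ν r c + z ≡ H r) gap-c (hook-decomposition r c c<R)
      where
      c<R : c < R r
      c<R = inside r (row⇒col hooks-decreasing y r y<Hr)

  core⇒closed : ∀ {a} → 1 ≤ a → IsCore a ν → ∀ y → a + y ∈ fcHooks ν → y ∈ fcHooks ν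
  core⇒closed {a} 1≤a core y a+y∈ with y ∈? fcHooks ν
  ... | yes y∈ = y∈
  ... | no  y∉ with Equivalence.to (∈⇔row (fcHooks ν) (a + y)) a+y∈
  ...   | r , _ , Hr≡a+y with Missing.missing⇒hook y y∉ r (subst (y <_) (sym Hr≡a+y) (+-monoˡ-≤ y 1≤a))
  ...     | c , c<R , hook+y≡Hr = ⊥-elim (core (r , c , c<R , +-cancelʳ-≡ y _ a (trans hook+y≡Hr Hr≡a+y)))

  core⇒closed* : ∀ {a} → 1 ≤ a → IsCore a ν → ∀ n y → n * a + y ∈ fcHooks ν → y ∈ fcHooks ν
  core⇒closed* 1≤a core zero    y y∈ = y∈
  core⇒closed* {a} 1≤a core (suc n) y h∈ = core⇒closed* 1≤a core n y
    (core⇒closed 1≤a core (n * a + y) (subst (_∈ fcHooks ν) (+-assoc a (n * a) y) h∈))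

  -- A simultaneous a-, b- and c-core (a, b, c ≥ 1) has no first-column hook in
  -- the numerical semigroup generated by a, b and c: stripping the generators
  -- off would reach 0, which is never a first-column hook.
  cores-avoid-semigroup : ∀ {a b c} → 1 ≤ a → 1 ≤ b → 1 ≤ c →
    IsCore a ν → IsCore b ν → IsCore c ν → ∀ x y z → x * a + y * b + z * c ∉ fcHooks ν
  cores-avoid-semigroup {a} {b} {c} 1≤a 1≤b 1≤c a-core b-core c-core x y z h∈ =
    0∉fcHooks P (core⇒closed* 1≤c c-core z 0
                (core⇒closed* 1≤b b-core y (z * c + 0)
                (core⇒closed* 1≤a a-core x (y * b + (z * c + 0))
                (subst (_∈ fcHooks ν) (regroup a b c x y z) h∈))))
    where
    regroup : ∀ a b c x y z → x * a + y * b + z * c ≡ x * a + (y * b + (z * c + 0))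
    regroup = solve-∀

below-head : ∀ {x xs z} → Linked _>_ (x ∷ xs) → z ∈ xs → z < x
below-head (p ∷ l) (here refl) = p
below-head (p ∷ l) (there z∈) = <-trans (below-head l z∈) p

at-most-head : ∀ {x xs z} → Linked _>_ (x ∷ xs) → z ∈ x ∷ xs → z ≤ x
at-most-head l (here refl) = ≤-refl
at-most-head l (there z∈)  = <⇒≤ (below-head l z∈)

drop-larger : ∀ {x y A B} → Linked _>_ (x ∷ A) → x < y → x ∷ A ⊆ y ∷ B → x ∷ A ⊆ B
drop-larger lA x<y A⊆B z∈ with A⊆B z∈
... | here refl = ⊥-elim (<⇒≱ x<y (at-most-head lA z∈))
... | there z∈B = z∈B

drop-equal : ∀ {x A B} → Linked _>_ (x ∷ A) → x ∷ A ⊆ x ∷ B → A ⊆ B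
drop-equal lA A⊆B z∈ with A⊆B (there z∈)
... | here refl = ⊥-elim (<-irrefl refl (below-head lA z∈))
... | there z∈B = z∈B

⊆-length : ∀ {A B} → Linked _>_ A → Linked _>_ B → A ⊆ B → length A ≤ length B
⊆-length {[]}    _  _  _   = z≤n
⊆-length {x ∷ A} {[]} _ _ A⊆B with () ← A⊆B (here refl)
⊆-length {x ∷ A} {y ∷ B} lA lB A⊆B with <-cmp x y
... | tri< x<y _ _  = m≤n⇒m≤1+n (⊆-length lA (Linked.tail lB) (drop-larger lA x<y A⊆B))
... | tri≈ _ refl _ = s≤s (⊆-length (Linked.tail lA) (Linked.tail lB) (drop-equal lA A⊆B))
... | tri> _ _ y<x  = ⊥-elim (<⇒≱ y<x (at-most-head lB (A⊆B (here refl))))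

⊆-equal : ∀ {A B} → Linked _>_ A → Linked _>_ B → A ⊆ B → length A ≡ length B → A ≡ B
⊆-equal {[]}    {[]}    _ _ _ _  = refl
⊆-equal {[]}    {_ ∷ _} _ _ _ ()
⊆-equal {x ∷ A} {[]}    _ _ _ ()
⊆-equal {x ∷ A} {y ∷ B} lA lB A⊆B eq with <-cmp x y
... | tri< x<y _ _  = ⊥-elim (<-irrefl eq (s≤s (⊆-length lA (Linked.tail lB) (drop-larger lA x<y A⊆B))))
... | tri≈ _ refl _ = cong (x ∷_)
      (⊆-equal (Linked.tail lA) (Linked.tail lB) (drop-equal lA A⊆B) (suc-injective eq))
... | tri> _ _ y<x  = ⊥-elim (<⇒≱ y<x (at-most-head lB (A⊆B (here refl))))

-- The abacus position of the bead in runner i + ℓ s and level j.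
position : (s m ℓ i j : ℕ) → ℕ
position s m ℓ i j = i + ℓ * s + j * (m * s)

Generated : (s m h : ℕ) → Set
Generated s m h = ∃ λ x → ∃ λ y → ∃ λ z → h ≡ x * s + y * (m * s ∸ 1) + z * (m * s + 1)

-- The non-bead positions i + ℓ s + j ms (with 1 ≤ i ≤ s) are generated:
-- when j ≥ i, when i + j ≥ s, and on the last runner block when i + j + 1 = s.
generated-deep : ∀ {s′ m′ ℓ i j e} → j ≡ i + e → Generated (suc s′) (suc m′) (position (suc s′) (suc m′) ℓ i j)
generated-deep {s′} {m′} {ℓ} {i} {e = e} refl = ℓ + e * suc m′ , 0 , i , identity s′ m′ ℓ i e
  where
  identity : ∀ s′ m′ ℓ i e → i + ℓ * suc s′ + (i + e) * (suc m′ * suc s′)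
    ≡ (ℓ + e * suc m′) * suc s′ + 0 * (s′ + m′ * suc s′) + i * (suc m′ * suc s′ + 1)
  identity = solve-∀

generated-wide : ∀ {s′ m′ ℓ i₀ j d e} → s′ ≡ i₀ + d → j ≡ d + e →
  Generated (suc s′) (suc m′) (position (suc s′) (suc m′) ℓ (suc i₀) j)
generated-wide {m′ = m′} {ℓ} {i₀} {d = d} {e} refl refl = suc ℓ + e * suc m′ , d , 0 , identity m′ ℓ i₀ d e
  where
  identity : ∀ m′ ℓ i₀ d e → suc i₀ + ℓ * suc (i₀ + d) + (d + e) * (suc m′ * suc (i₀ + d))
    ≡ (suc ℓ + e * suc m′) * suc (i₀ + d) + d * ((i₀ + d) + m′ * suc (i₀ + d)) + 0 * (suc m′ * suc (i₀ + d) + 1)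
  identity = solve-∀

generated-edge : ∀ {s′ m′ i j} → s′ ≡ i + j →
  Generated (suc s′) (suc m′) (position (suc s′) (suc m′) m′ i j)
generated-edge {m′ = m′} {i} {j} refl = 0 , suc j , 0 , identity m′ i j
  where
  identity : ∀ m′ i j → i + m′ * suc (i + j) + j * (suc m′ * suc (i + j))
    ≡ 0 * suc (i + j) + suc j * ((i + j) + m′ * suc (i + j)) + 0 * (suc m′ * suc (i + j) + 1)
  identity = solve-∀

data BeadRange (s m ℓ i j : ℕ) : Set where
  early-block : suc ℓ < m → i + j < s → BeadRange s m ℓ i j
  last-block  : suc ℓ ≡ m → suc (i + j) < s → BeadRange s m ℓ i j

BeadAt : (s m h ℓ i j : ℕ) → Set
BeadAt s m h ℓ i j = h ≡ position s m ℓ i j × j < i × BeadRange s m ℓ i j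

Bead : (s m h : ℕ) → Set
Bead s m h = ∃ λ ℓ → ∃ λ i → ∃ λ j → BeadAt s m h ℓ i j

-- j < i, written with truncated subtraction as in the statement.
<⇔≤∸1 : ∀ {i j} → j < i ⇔ (1 ≤ i × j ≤ i ∸ 1)
<⇔≤∸1 {zero}  = mk⇔ (λ ()) (λ { (() , _) })
<⇔≤∸1 {suc i} = mk⇔ (λ { (s≤s j≤i) → s≤s z≤n , j≤i }) (λ { (_ , j≤i) → s≤s j≤i })

sum-bound⇔ : ∀ c i j s → i + j + c ≤ s ⇔ (i + c ≤ s × j ≤ s ∸ i ∸ c)
sum-bound⇔ c i j s = mk⇔
  (λ bound → ≤-trans (+-monoˡ-≤ c (m≤m+n i j)) bound ,
             subst (j ≤_) (sym (∸-+-assoc s i c)) (m+n≤o⇒m≤o∸n j (subst (_≤ s) (reorder i j c) bound)))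
  (λ { (i+c≤s , j≤) → subst (_≤ s) (sym (reorder i j c))
         (m≤o∸n⇒m+n≤o j i+c≤s (subst (j ≤_) (∸-+-assoc s i c) j≤)) })
  where
  reorder : ∀ i j c → i + j + c ≡ j + (i + c)
  reorder = solve-∀

Target⇔Bead : ∀ s m′ h → Target s (suc m′) h ⇔ Bead s (suc m′) h
Target⇔Bead s m′ h = mk⇔ to from
  where
  to : Target s (suc m′) h → Bead s (suc m′) h
  to (inj₁ (ℓ , i , j , ℓ+2≤m , 1≤i , i+1≤s , j≤i∸1 , j≤ , eq)) =
    ℓ , i , j , eq , Equivalence.from <⇔≤∸1 (1≤i , j≤i∸1) ,
    early-block (subst (_≤ suc m′) (+-comm ℓ 2) ℓ+2≤m)
                (subst (_≤ s) (+-comm (i + j) 1) (Equivalence.from (sum-bound⇔ 1 i j s) (i+1≤s , j≤)))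
  to (inj₂ (i , j , 1≤i , i+2≤s , j≤i∸1 , j≤ , eq)) =
    m′ , i , j , eq , Equivalence.from <⇔≤∸1 (1≤i , j≤i∸1) ,
    last-block refl (subst (_≤ s) (+-comm (i + j) 2) (Equivalence.from (sum-bound⇔ 2 i j s) (i+2≤s , j≤)))
  from : Bead s (suc m′) h → Target s (suc m′) h
  from (ℓ , i , j , eq , j<i , early-block ℓ+1<m i+j<s) =
    inj₁ (ℓ , i , j , subst (_≤ suc m′) (+-comm 2 ℓ) ℓ+1<m , proj₁ (Equivalence.to <⇔≤∸1 j<i) ,
          proj₁ bounds , proj₂ (Equivalence.to <⇔≤∸1 j<i) , proj₂ bounds , eq)
    where
    bounds : i + 1 ≤ s × j ≤ s ∸ i ∸ 1
    bounds = Equivalence.to (sum-bound⇔ 1 i j s) (subst (_≤ s) (+-comm 1 (i + j)) i+j<s)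
  from (ℓ , i , j , eq , j<i , last-block refl i+j+1<s) =
    inj₂ (i , j , proj₁ (Equivalence.to <⇔≤∸1 j<i) , proj₁ bounds ,
          proj₂ (Equivalence.to <⇔≤∸1 j<i) , proj₂ bounds , eq)
    where
    bounds : i + 2 ≤ s × j ≤ s ∸ i ∸ 2
    bounds = Equivalence.to (sum-bound⇔ 2 i j s) (subst (_≤ s) (+-comm 2 (i + j)) i+j+1<s)

module Numerics (s′ m′ : ℕ) where

  s m N : ℕ
  s = suc s′
  m = suc m′
  N = m * s

  mixed-radix : ∀ h → ∃ λ ℓ → ∃ λ i → ∃ λ j → h ≡ position s m ℓ i j × i < s × ℓ < m
  mixed-radix h = r / s , r % s , h / N , expansion , m%n<n r s , m<n*o⇒m/o<n (m%n<n h N)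
    where
    r : ℕ
    r = h % N
    expansion : h ≡ r % s + r / s * s + h / N * N
    expansion = trans (m≡m%n+[m/n]*n h N) (cong (_+ h / N * N) (m≡m%n+[m/n]*n r s))

  classify : ∀ ℓ i₀ j → suc i₀ ≤ s → ℓ < m →
    Bead s m (position s m ℓ (suc i₀) j) ⊎ Generated s m (position s m ℓ (suc i₀) j)
  classify ℓ i₀ j i≤s ℓ<m with suc i₀ ≤? j
  ... | yes i≤j = inj₂ (generated-deep {s′} {m′} {ℓ} {suc i₀} (sym (m+[n∸m]≡n i≤j)))
  ... | no  i≰j with s ≤? suc i₀ + j
  ...   | yes s≤i+j = inj₂ (generated-wide {s′} {m′} {ℓ} (sym (m+[n∸m]≡n i₀≤s′)) (sym (m+[n∸m]≡n d≤j)))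
    where
    i₀≤s′ : i₀ ≤ s′
    i₀≤s′ = s≤s⁻¹ i≤s
    d≤j : s′ ∸ i₀ ≤ j
    d≤j = +-cancelˡ-≤ i₀ (s′ ∸ i₀) j (subst (_≤ i₀ + j) (sym (m+[n∸m]≡n i₀≤s′)) (s≤s⁻¹ s≤i+j))
  ...   | no  s≰i+j with suc ℓ <? m
  ...     | yes ℓ+1<m = inj₁ (ℓ , suc i₀ , j , refl , ≰⇒> i≰j , early-block ℓ+1<m (≰⇒> s≰i+j))
  ...     | no  ℓ+1≮m with suc (suc i₀ + j) <? s
  ...       | yes i+j+1<s = inj₁ (ℓ , suc i₀ , j , refl , ≰⇒> i≰j , last-block ℓ+1≡m i+j+1<s)
    where
    ℓ+1≡m : suc ℓ ≡ m
    ℓ+1≡m = ≤-antisym ℓ<m (≮⇒≥ ℓ+1≮m)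
  ...       | no  i+j+1≮s = inj₂ (subst (λ ℓ → Generated s m (position s m ℓ (suc i₀) j)) (sym ℓ≡m′)
                                       (generated-edge {s′} {m′} {suc i₀} s′≡i+j))
    where
    ℓ≡m′ : ℓ ≡ m′
    ℓ≡m′ = suc-injective (≤-antisym ℓ<m (≮⇒≥ ℓ+1≮m))
    s′≡i+j : s′ ≡ suc i₀ + j
    s′≡i+j = suc-injective (≤-antisym (≮⇒≥ i+j+1≮s) (≰⇒> s≰i+j))

  bead-or-generated : ∀ h → Bead s m h ⊎ Generated s m h
  bead-or-generated zero    = inj₂ (0 , 0 , 0 , refl)
  bead-or-generated (suc h) with mixed-radix h
  ... | ℓ , i₀ , j , refl , i₀<s , ℓ<m = classify ℓ i₀ j i₀<s ℓ<m

  digits-bound : ∀ {ℓ i j} → BeadRange s m ℓ i j → i + ℓ * s < N ∸ 1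
  digits-bound {i = i} (early-block ℓ+1<m i+j<s) =
    +-mono-≤-< (s≤s⁻¹ (m+n≤o⇒m≤o (suc i) i+j<s)) (*-monoˡ-< s (s≤s⁻¹ ℓ+1<m))
  digits-bound {i = i} (last-block refl i+j+1<s) =
    +-monoˡ-< (m′ * s) (s≤s⁻¹ (m+n≤o⇒m≤o (suc (suc i)) i+j+1<s))

  range-sum : ∀ {ℓ i j} → BeadRange s m ℓ i j → i + j < s
  range-sum (early-block _ i+j<s)  = i+j<s
  range-sum (last-block _ i+j+1<s) = <-trans (n<1+n _) i+j+1<s

  range-block : ∀ {ℓ i j} → BeadRange s m ℓ i j → ℓ < m
  range-block (early-block ℓ+1<m _) = <-trans (n<1+n _) ℓ+1<m
  range-block (last-block refl _)   = ≤-refl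

  level0-below : ∀ {ℓ i j} → BeadRange s m ℓ i j → ∀ {y} → N ∸ 1 ≤ y → y ≢ position s m ℓ i 0
  level0-below {ℓ} {i} range N∸1≤y y≡pos =
    <⇒≱ (digits-bound range) (subst (N ∸ 1 ≤_) (trans y≡pos (+-identityʳ (i + ℓ * s))) N∸1≤y)

  range-mono : ∀ {ℓ i j i′ j′} → i′ + j′ ≤ i + j → BeadRange s m ℓ i j → BeadRange s m ℓ i′ j′
  range-mono le (early-block ℓ+1<m i+j<s) = early-block ℓ+1<m (≤-<-trans le i+j<s)
  range-mono le (last-block ℓ+1≡m i+j+1<s) = last-block ℓ+1≡m (≤-<-trans (s≤s le) i+j+1<s)

  bead-minus-s : ∀ x → Bead s m (s + x) → Bead s m x
  bead-minus-s x (suc ℓ , i , j , eq , j<i , range) =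
    ℓ , i , j , +-cancelˡ-≡ s _ _ (trans eq (identity s′ m′ ℓ i j)) , j<i ,
    early-block (range-block range) (range-sum range)
    where
    identity : ∀ s′ m′ ℓ i j → i + suc ℓ * suc s′ + j * (suc m′ * suc s′)
      ≡ suc s′ + (i + ℓ * suc s′ + j * (suc m′ * suc s′))
    identity = solve-∀
  bead-minus-s x (zero , i , zero , eq , j<i , range) =
    ⊥-elim (<⇒≱ (range-sum range) (subst (s ≤_) (trans eq (+-identityʳ (i + 0))) (m≤m+n s x)))
  bead-minus-s x (zero , i , suc j , eq , j<i , range) =
    m′ , i , j , +-cancelˡ-≡ s _ _ (trans eq (identity s′ m′ i j)) , <-trans (n<1+n j) j<i ,
    last-block refl (subst (_< s) (+-suc i j) (range-sum range))
    where
    identity : ∀ s′ m′ i j → i + 0 * suc s′ + suc j * (suc m′ * suc s′)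
      ≡ suc s′ + (i + m′ * suc s′ + j * (suc m′ * suc s′))
    identity = solve-∀

  bead-minus-N+1 : ∀ x → Bead s m (N + 1 + x) → Bead s m x
  bead-minus-N+1 x (ℓ , i , zero , eq , j<i , range) =
    ⊥-elim (level0-below range (≤-trans (m∸n≤m N 1) (≤-trans (m≤m+n N 1) (m≤m+n (N + 1) x))) eq)
  bead-minus-N+1 x (ℓ , suc i , suc j , eq , s≤s j<i , range) =
    ℓ , i , j , +-cancelˡ-≡ (N + 1) _ _ (trans eq (identity s′ m′ ℓ i j)) , j<i ,
    range-mono (+-mono-≤ (n≤1+n i) (n≤1+n j)) range
    where
    identity : ∀ s′ m′ ℓ i j → suc i + ℓ * suc s′ + suc j * (suc m′ * suc s′)
      ≡ suc m′ * suc s′ + 1 + (i + ℓ * suc s′ + j * (suc m′ * suc s′))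
    identity = solve-∀

  bead-minus-N∸1 : ∀ x → Bead s m (N ∸ 1 + x) → Bead s m x
  bead-minus-N∸1 x (ℓ , i , zero , eq , j<i , range) =
    ⊥-elim (level0-below range (m≤m+n (N ∸ 1) x) eq)
  bead-minus-N∸1 x (ℓ , i , suc j , eq , j<i , range) =
    ℓ , suc i , j , +-cancelˡ-≡ (N ∸ 1) _ _ (trans eq (identity s′ m′ ℓ i j)) ,
    <-trans (n<1+n j) (m<n⇒m<1+n j<i) , range-mono (≤-reflexive (sym (+-suc i j))) range
    where
    identity : ∀ s′ m′ ℓ i j → i + ℓ * suc s′ + suc j * (suc m′ * suc s′)
      ≡ (s′ + m′ * suc s′) + (suc i + ℓ * suc s′ + j * (suc m′ * suc s′))
    identity = solve-∀

  bead-bound : ∀ {h} → Bead s m h → h < s * N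
  bead-bound (ℓ , i , j , refl , j<i , range) = begin-strict
    i + ℓ * s + j * N   <⟨ +-monoˡ-< (j * N) (<-≤-trans (digits-bound range) (m∸n≤m N 1)) ⟩
    N + j * N           ≤⟨ *-monoˡ-≤ N (<-trans j<i (m+n≤o⇒m≤o (suc i) (range-sum range))) ⟩
    s * N               ∎
    where open ≤-Reasoning

  bead-positive : ∀ {h} → Bead s m h → 0 < h
  bead-positive (ℓ , i , j , refl , j<i , range) =
    <-≤-trans (≤-<-trans z≤n j<i) (≤-trans (m≤m+n i (ℓ * s)) (m≤m+n (i + ℓ * s) (j * N)))

  range? : ∀ ℓ i j → Dec (BeadRange s m ℓ i j)
  range? ℓ i j = map′ [ uncurry early-block , uncurry last-block ]′ split
    ((suc ℓ <? m ×-dec i + j <? s) ⊎-dec (suc ℓ ≟ m ×-dec suc (i + j) <? s))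
    where
    split : BeadRange s m ℓ i j → (suc ℓ < m × i + j < s) ⊎ (suc ℓ ≡ m × suc (i + j) < s)
    split (early-block ℓ+1<m i+j<s) = inj₁ (ℓ+1<m , i+j<s)
    split (last-block ℓ+1≡m i+j+1<s) = inj₂ (ℓ+1≡m , i+j+1<s)

  bead? : ∀ h → Dec (Bead s m h)
  bead? h = map′ unbound bound
    (anyUpTo? (λ ℓ → anyUpTo? (λ i → anyUpTo? (λ j →
      (h ≟ position s m ℓ i j) ×-dec (j <? i) ×-dec range? ℓ i j) s) s) m)
    where
    BoundedBead : Set
    BoundedBead = ∃ λ ℓ → ℓ < m × ∃ λ i → i < s × ∃ λ j → j < s × BeadAt s m h ℓ i j
    unbound : BoundedBead → Bead s m h
    unbound (ℓ , _ , i , _ , j , _ , bead) = ℓ , i , j , bead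
    bound : Bead s m h → BoundedBead
    bound (ℓ , i , j , bead@(_ , j<i , range)) =
      ℓ , range-block range , i , i<s , j , <-trans j<i i<s , bead
      where
      i<s : i < s
      i<s = m+n≤o⇒m≤o (suc i) (range-sum range)

  beads : List ℕ
  beads = filter bead? (downFrom (s * N))

  beads-strict : Linked _>_ beads
  beads-strict = filter⁺ bead? (λ y<x z<y → <-trans z<y y<x) (applyDownFrom⁺₂ (λ x → x) (s * N) n<1+n)

  ∈beads⇔ : ∀ h → h ∈ beads ⇔ Bead s m h
  ∈beads⇔ h = mk⇔ (λ h∈ → proj₂ (∈-filter⁻ bead? {xs = downFrom (s * N)} h∈))
                  (λ bead → ∈-filter⁺ bead? (∈-downFrom⁺ (bead-bound bead)) bead)

  beads-positive : All (0 <_) beads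
  beads-positive = tabulate (λ h∈ → bead-positive (Equivalence.to (∈beads⇔ _) h∈))

module LargestCore (s′ m′ : ℕ) (2≤N : 2 ≤ suc m′ * suc s′) where
  open Numerics s′ m′

  μ : List ℕ
  μ = fromHooks beads

  μ-partition : IsPartition μ
  μ-partition = fromHooks-partition beads-strict beads-positive

  ∈fcHooks-μ⇔ : ∀ h → h ∈ fcHooks μ ⇔ Bead s m h
  ∈fcHooks-μ⇔ h = subst (λ H → h ∈ H ⇔ Bead s m h)
    (sym (fcHooks-fromHooks beads-strict beads-positive)) (∈beads⇔ h)

  μ-core : ∀ g → (∀ x → Bead s m (g + x) → Bead s m x) → IsCore g μ
  μ-core g closed = HookDictionary.closed⇒core μ-partition g λ x g+x∈ →
    Equivalence.from (∈fcHooks-μ⇔ x) (closed x (Equivalence.to (∈fcHooks-μ⇔ (g + x)) g+x∈))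

  μ-simcore : SimCore s m μ
  μ-simcore = μ-core s bead-minus-s , μ-core (N ∸ 1) bead-minus-N∸1 , μ-core (N + 1) bead-minus-N+1

  hooks⊆beads : ∀ {ν} → IsPartition ν → SimCore s m ν → fcHooks ν ⊆ fcHooks μ
  hooks⊆beads P (s-core , N∸1-core , N+1-core) {h} h∈ with bead-or-generated h
  ... | inj₁ bead = Equivalence.from (∈fcHooks-μ⇔ h) bead
  ... | inj₂ (x , y , z , refl) = ⊥-elim (HookDictionary.cores-avoid-semigroup P
          (s≤s z≤n) (s≤s⁻¹ 2≤N) (m≤n+m 1 N) s-core N∸1-core N+1-core x y z h∈)

  μ-largest : ∀ ν → IsPartition ν → SimCore s m ν → length ν ≤ length μ
  μ-largest ν P core = subst₂ _≤_ (length-fcHooks ν) (length-fcHooks μ)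
    (⊆-length (fcHooks-strict (proj₁ P)) (fcHooks-strict (proj₁ μ-partition)) (hooks⊆beads P core))

  μ-unique : ∀ ν → IsPartition ν → SimCore s m ν → length ν ≡ length μ → ν ≡ μ
  μ-unique ν P core eq = fcHooks-injective ν μ
    (⊆-equal (fcHooks-strict (proj₁ P)) (fcHooks-strict (proj₁ μ-partition)) (hooks⊆beads P core)
      (trans (length-fcHooks ν) (trans eq (sym (length-fcHooks μ)))))

  μ-first-column : ∀ h → FirstColHook μ h ⇔ Target s m h
  μ-first-column h =
    ⇔-trans (FirstColHook⇔∈ μ-partition h) (⇔-trans (∈fcHooks-μ⇔ h) (⇔-sym (Target⇔Bead s m′ h)))

lemma5p13 : (s m : ℕ) → 1 ≤ s → 1 ≤ m → 2 ≤ m * s →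
    Σ (List ℕ) (λ μ →
      IsPartition μ × SimCore s m μ ×
      ((ν : List ℕ) → IsPartition ν → SimCore s m ν → length ν ≤ length μ) ×
      ((ν : List ℕ) → IsPartition ν → SimCore s m ν → length ν ≡ length μ → ν ≡ μ) ×
      ((h : ℕ) → FirstColHook μ h ⇔ Target s m h))
lemma5p13 (suc s′) (suc m′) _ _ 2≤ms =
  μ , μ-partition , μ-simcore , μ-largest , μ-unique , μ-first-column
  where open LargestCore s′ m′ 2≤ms
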